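{- Let $F$ be a non-archimedean ordered field, $\mathcal{C}$ the set of all convex subgroups of $(F,+)$, and $Q=\{a+A: a\in F, A\in\mathcal{C}\}$ with addition $(a+A)+(b+B)=a+b+A+B$. Then $(Q,+)$ is an assembly.
   Context: A subset of $F$ is convex if it contains every element lying between two of its elements. A non-empty structure $(\mathcal{A},+)$ is an assembly if: (1) $+$ is associative; (2) $+$ is commutative; (3) for every $x$ there is $e$ with $x+e=x$ and such that for all $f$ with $x+f=x$ one has $e+f=e$ (this $e$ is unique and denoted $e(x)$); (4) for every $x$ there is $s$ with $x+s=e(x)$ and $e(s)=e(x)$; (5) for all $x,y$: $e(x+y)=e(x)$ or $e(x+y)=e(y)$. -}

module Defs where

open import Level using (0ℓ)
open import Data.Nat using (ℕ; zero; suc)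
open import Data.Product using (Σ; ∃; _×_; _,_)
open import Data.Sum using (_⊎_)
open import Relation.Nullary using (¬_)
open import Relation.Binary.PropositionalEquality using (_≡_)
open import Algebra.Structures using (IsCommutativeRing)
open import Relation.Binary.Structures using (IsTotalOrder)
open import Function.Bundles using (_⇔_)

record OrderedField : Set₁ where
  infixl 6 _+_
  infixl 7 _*_
  infix 4 _≤_ _<_
  field
    Carrier : Set
    _+_ _*_ : Carrier → Carrier → Carrier
    -_ : Carrier → Carrier
    0# 1# : Carrier
    _≤_ : Carrier → Carrier → Set
    isCommutativeRing : IsCommutativeRing _≡_ _+_ _*_ -_ 0# 1#
    0≢1 : ¬ (0# ≡ 1#)
    inverse : ∀ x → ¬ (x ≡ 0#) → ∃ λ y → x * y ≡ 1#
    isTotalOrder : IsTotalOrder _≡_ _≤_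
    +-mono-≤ : ∀ {x y} z → x ≤ y → x + z ≤ y + z
    *-nonneg : ∀ {x y} → 0# ≤ x → 0# ≤ y → 0# ≤ x * y

  _<_ : Carrier → Carrier → Set
  x < y = x ≤ y × ¬ (x ≡ y)

  fromℕ : ℕ → Carrier
  fromℕ zero = 0#
  fromℕ (suc n) = 1# + fromℕ n

  Archimedean : Set
  Archimedean = ∀ x → ∃ λ (n : ℕ) → x < fromℕ n

  NonArchimedean : Set
  NonArchimedean = ¬ Archimedean

  Subset : Set₁
  Subset = Carrier → Set

  record IsConvexSubgroup (A : Subset) : Set where
    field
      has-0 : A 0#
      +-closed : ∀ {x y} → A x → A y → A (x + y)
      neg-closed : ∀ {x} → A x → A (- x)
      convex : ∀ {x y z} → A x → A y → x ≤ z → z ≤ y → A z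

  infix 4 _≐_
  _≐_ : Subset → Subset → Set
  S ≐ T = ∀ z → S z ⇔ T z

  coset : Carrier → Subset → Subset
  coset a A z = ∃ λ x → A x × z ≡ a + x

  infixl 6 _⊕_
  _⊕_ : Subset → Subset → Subset
  (S ⊕ T) z = ∃ λ x → ∃ λ y → S x × T y × z ≡ x + y

  Q : Subset → Set₁
  Q S = ∃ λ (a : Carrier) → Σ Subset λ A → IsConvexSubgroup A × S ≐ coset a A

-- Assembly, for a set X carved out by a predicate P of a type X with
-- an equivalence _≈_ (the equality of the structure) and operation _∙_.
record IsAssembly {X : Set₁} (P : X → Set₁) (_≈_ : X → X → Set) (_∙_ : X → X → X) : Set₁ where
  -- e is the (unique) e(x) of axiom (3)
  IsNeutralOf : X → X → Set₁
  IsNeutralOf x e = P e × (x ∙ e) ≈ x × (∀ f → P f → (x ∙ f) ≈ x → (e ∙ f) ≈ e)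
  field
    closed : ∀ x y → P x → P y → P (x ∙ y)
    ∙-cong : ∀ x x' y y' → x ≈ x' → y ≈ y' → (x ∙ y) ≈ (x' ∙ y')
    assoc : ∀ x y z → P x → P y → P z → ((x ∙ y) ∙ z) ≈ (x ∙ (y ∙ z))
    comm : ∀ x y → P x → P y → (x ∙ y) ≈ (y ∙ x)
    neutral : ∀ x → P x → ∃ λ e → IsNeutralOf x e
    inverse : ∀ x e → P x → IsNeutralOf x e →
      ∃ λ s → P s × (x ∙ s) ≈ e × IsNeutralOf s e
    neutral-sum : ∀ x y ex ey exy → P x → P y →
      IsNeutralOf x ex → IsNeutralOf y ey → IsNeutralOf (x ∙ y) exy →
      exy ≈ ex ⊎ exy ≈ ey

module Submission where

-- The argument only uses two facts about the convex subgroups of an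
-- ordered field F: they are subgroups of (F,+), and (classically) any two
-- of them are comparable under inclusion.  We therefore prove the more
-- general statement that for ANY chain 𝒞 of subgroups of (F,+) the cosets
-- a + A (A ∈ 𝒞), with Minkowski addition, form an assembly:
--   * (a + A) + (b + B) = (a + b) + (A + B), and A + B = max(A, B) for a chain;
--   * a coset b + B stabilises a + A exactly when b ∈ A and B ⊆ A,
--     so e(a + A) = A, the inverse of a + A is -a + A, and
--     e((a + A) + (b + B)) = max(A, B) is one of e(a + A), e(b + B).

open import Defs
open import Level using (suc; zero; lift; lower)
open import Axiom.ExcludedMiddle using (ExcludedMiddle)
open import Data.Product using (∃; _×_; _,_; proj₁; proj₂)
open import Data.Sum using (_⊎_; inj₁; inj₂)
open import Relation.Nullary using (¬_; Dec; yes; no; contradiction)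
open import Relation.Nullary.Decidable using (map′; decidable-stable)
open import Relation.Binary.PropositionalEquality
  using (_≡_; refl; sym; trans; cong; cong₂; subst; subst₂)
open import Algebra.Bundles using (CommutativeRing)
open import Relation.Binary.Structures using (IsTotalOrder)
open import Function.Bundles using (mk⇔; Equivalence)
import Algebra.Properties.Group as GroupProperties
import Algebra.Properties.CommutativeSemigroup as CommutativeSemigroupProperties

module Cosets (F : OrderedField) where
  open OrderedField F

  ring : CommutativeRing _ _
  ring = record { isCommutativeRing = isCommutativeRing }

  open CommutativeRing ring using (+-assoc; +-comm; +-identityˡ; +-identityʳ; -‿inverseʳ)
  open GroupProperties (CommutativeRing.+-group ring)
    using (∙-cancelˡ; \\-leftDividesˡ; \\-leftDividesʳ; ⁻¹-involutive; ε⁻¹≈ε)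
  open CommutativeSemigroupProperties (CommutativeRing.+-commutativeSemigroup ring)
    using (interchange)
  open IsTotalOrder isTotalOrder using (total)

  ≐-refl : ∀ {S} → S ≐ S
  ≐-refl z = mk⇔ (λ s → s) (λ s → s)

  ≐-sym : ∀ {S T} → S ≐ T → T ≐ S
  ≐-sym S≐T z = mk⇔ (Equivalence.from (S≐T z)) (Equivalence.to (S≐T z))

  ≐-trans : ∀ {S T U} → S ≐ T → T ≐ U → S ≐ U
  ≐-trans S≐T T≐U z =
    mk⇔ (λ s → Equivalence.to (T≐U z) (Equivalence.to (S≐T z) s))
        (λ u → Equivalence.from (S≐T z) (Equivalence.from (T≐U z) u))

  infix 4 _⊆_
  _⊆_ : Subset → Subset → Set
  A ⊆ B = ∀ {x} → A x → B x

  ⊆-of-≐ : ∀ {S T} → S ≐ T → S ⊆ T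
  ⊆-of-≐ S≐T {x} = Equivalence.to (S≐T x)

  ⊕-cong : ∀ {S S' T T'} → S ≐ S' → T ≐ T' → (S ⊕ T) ≐ (S' ⊕ T')
  ⊕-cong S≐S' T≐T' z =
    mk⇔ (λ (x , y , sx , ty , eq) → x , y , ⊆-of-≐ S≐S' sx , ⊆-of-≐ T≐T' ty , eq)
        (λ (x , y , sx , ty , eq) → x , y , ⊆-of-≐ (≐-sym S≐S') sx , ⊆-of-≐ (≐-sym T≐T') ty , eq)

  ⊕-comm : ∀ S T → (S ⊕ T) ≐ (T ⊕ S)
  ⊕-comm S T z =
    mk⇔ (λ (x , y , sx , ty , eq) → y , x , ty , sx , trans eq (+-comm x y))
        (λ (x , y , tx , sy , eq) → y , x , sy , tx , trans eq (+-comm x y))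

  ⊕-assoc : ∀ S T U → ((S ⊕ T) ⊕ U) ≐ (S ⊕ (T ⊕ U))
  ⊕-assoc S T U z = mk⇔
    (λ (_ , u , (s , t , ss , tt , e₁) , uu , e₂) →
       s , t + u , ss , (t , u , tt , uu , refl) ,
       trans e₂ (trans (cong (_+ u) e₁) (+-assoc s t u)))
    (λ (s , _ , ss , (t , u , tt , uu , e₁) , e₂) →
       s + t , u , (s , t , ss , tt , refl) , uu ,
       trans e₂ (trans (cong (s +_) e₁) (sym (+-assoc s t u))))

  coset-cong : ∀ {a A B} → A ≐ B → coset a A ≐ coset a B
  coset-cong A≐B z =
    mk⇔ (λ (x , ax , eq) → x , ⊆-of-≐ A≐B ax , eq)
        (λ (x , bx , eq) → x , ⊆-of-≐ (≐-sym A≐B) bx , eq)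

  coset-⊕ : ∀ a A b B → (coset a A ⊕ coset b B) ≐ coset (a + b) (A ⊕ B)
  coset-⊕ a A b B z = mk⇔
    (λ (_ , _ , (x , ax , e₁) , (y , by , e₂) , e₃) →
       x + y , (x , y , ax , by , refl) ,
       trans e₃ (trans (cong₂ _+_ e₁ e₂) (interchange a x b y)))
    (λ (_ , (x , y , ax , by , e₁) , e₂) →
       a + x , b + y , (x , ax , refl) , (y , by , refl) ,
       trans e₂ (trans (cong ((a + b) +_) e₁) (sym (interchange a x b y))))

  -- Subgroups of (F,+): the only structure of convex subgroups the coset
  -- algebra needs.
  record IsSubgroup (A : Subset) : Set where
    field
      has-0 : A 0#
      +-closed : ∀ {x y} → A x → A y → A (x + y)
      neg-closed : ∀ {x} → A x → A (- x)

  module _ {A : Subset} (A-sub : IsSubgroup A) where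
    open IsSubgroup A-sub

    coset-0# : A ≐ coset 0# A
    coset-0# z =
      mk⇔ (λ az → z , az , sym (+-identityˡ z))
          (λ (x , ax , eq) → subst A (sym (trans eq (+-identityˡ x))) ax)

    coset-shift : ∀ a {c} → A c → coset (a + c) A ≐ coset a A
    coset-shift a {c} ac z = mk⇔
      (λ (x , ax , eq) → c + x , +-closed ac ax , trans eq (+-assoc a c x))
      (λ (x , ax , eq) → - c + x , +-closed (neg-closed ac) ax ,
         trans eq (trans (cong (a +_) (sym (\\-leftDividesˡ c x))) (sym (+-assoc a c (- c + x)))))

    coset-of-member : ∀ {c} → A c → coset c A ≐ A
    coset-of-member {c} ac =
      ≐-trans (subst (λ d → coset d A ≐ coset 0# A) (+-identityˡ c) (coset-shift 0# ac))
              (≐-sym coset-0#)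

    ⊕-absorb : ∀ {B} → B 0# → B ⊆ A → (A ⊕ B) ≐ A
    ⊕-absorb b0 B⊆A z = mk⇔
      (λ (x , y , ax , by , eq) → subst A (sym eq) (+-closed ax (B⊆A by)))
      (λ az → z , 0# , az , b0 , sym (+-identityʳ z))

    stabiliser-intro : ∀ a {b B} → IsSubgroup B → A b → B ⊆ A →
                       (coset a A ⊕ coset b B) ≐ coset a A
    stabiliser-intro a {b} {B} B-sub ab B⊆A =
      ≐-trans (coset-⊕ a A b B)
        (≐-trans (coset-cong (⊕-absorb (IsSubgroup.has-0 B-sub) B⊆A)) (coset-shift a ab))

    stabiliser-elim : ∀ a {b B} → IsSubgroup B →
                      (coset a A ⊕ coset b B) ≐ coset a A → A b × B ⊆ A
    stabiliser-elim a {b} {B} B-sub stab = ab , B⊆A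
      where
        shifted : ∀ {y} → B y → A (b + y)
        shifted {y} by with ⊆-of-≐ stab (a + 0# , b + y , (0# , has-0 , refl) , (y , by , refl) , refl)
        ... | x , ax , eq = subst A (sym (∙-cancelˡ a (b + y) x
                                   (trans (cong (_+ (b + y)) (sym (+-identityʳ a))) eq))) ax

        ab : A b
        ab = subst A (+-identityʳ b) (shifted (IsSubgroup.has-0 B-sub))

        B⊆A : B ⊆ A
        B⊆A {y} by = subst A (\\-leftDividesʳ b y) (+-closed (neg-closed ab) (shifted by))

  IsNeutralOf : (Subset → Set₁) → Subset → Subset → Set₁
  IsNeutralOf P x e = P e × (x ⊕ e) ≐ x × (∀ f → P f → (x ⊕ f) ≐ x → (e ⊕ f) ≐ e)

  module Chain (𝒞 : Subset → Set)
               (subgroup : ∀ {A} → 𝒞 A → IsSubgroup A)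
               (chain : ∀ {A B} → 𝒞 A → 𝒞 B → B ⊆ A ⊎ A ⊆ B) where

    Coset𝒞 : Subset → Set₁
    Coset𝒞 S = ∃ λ (a : Carrier) → ∃ λ (A : Subset) → 𝒞 A × S ≐ coset a A

    LargerCoset : Subset → Subset → Subset → Subset → Set₁
    LargerCoset A B X Y =
      ∃ λ (c : Carrier) → ∃ λ (C : Subset) → 𝒞 C × (X ⊕ Y) ≐ coset c C × (C ≡ A ⊎ C ≡ B)

    sum-of-cosets : ∀ {X Y a b A B} → 𝒞 A → 𝒞 B → X ≐ coset a A → Y ≐ coset b B →
                    LargerCoset A B X Y
    sum-of-cosets {X} {Y} {a} {b} {A} {B} 𝒞A 𝒞B X≐ Y≐ = larger (chain 𝒞A 𝒞B)
      where
        sum : (X ⊕ Y) ≐ coset (a + b) (A ⊕ B)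
        sum = ≐-trans (⊕-cong X≐ Y≐) (coset-⊕ a A b B)

        larger : B ⊆ A ⊎ A ⊆ B → LargerCoset A B X Y
        larger (inj₁ B⊆A) = a + b , A , 𝒞A ,
          ≐-trans sum (coset-cong (⊕-absorb (subgroup 𝒞A) (IsSubgroup.has-0 (subgroup 𝒞B)) B⊆A)) ,
          inj₁ refl
        larger (inj₂ A⊆B) = a + b , B , 𝒞B ,
          ≐-trans sum (coset-cong (≐-trans (⊕-comm A B)
            (⊕-absorb (subgroup 𝒞B) (IsSubgroup.has-0 (subgroup 𝒞A)) A⊆B))) ,
          inj₂ refl

    subgroup-is-coset : ∀ {A} → 𝒞 A → Coset𝒞 A
    subgroup-is-coset 𝒞A = 0# , _ , 𝒞A , coset-0# (subgroup 𝒞A)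

    stabilises : ∀ {X f a b A B} → 𝒞 A → 𝒞 B → X ≐ coset a A → f ≐ coset b B →
                 (X ⊕ f) ≐ X → A b × B ⊆ A
    stabilises {a = a} 𝒞A 𝒞B X≐ f≐ stab = stabiliser-elim (subgroup 𝒞A) a (subgroup 𝒞B)
      (≐-trans (⊕-cong (≐-sym X≐) (≐-sym f≐)) (≐-trans stab X≐))

    subgroup-neutral : ∀ {X a A} → 𝒞 A → X ≐ coset a A → IsNeutralOf Coset𝒞 X A
    subgroup-neutral {a = a} {A} 𝒞A X≐ =
      subgroup-is-coset 𝒞A ,
      ≐-trans (⊕-cong X≐ (coset-0# A-sub))
        (≐-trans (stabiliser-intro A-sub a A-sub (IsSubgroup.has-0 A-sub) (λ x → x)) (≐-sym X≐)) ,
      λ { f (_ , B , 𝒞B , f≐) stab →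
          let (ab , B⊆A) = stabilises 𝒞A 𝒞B X≐ f≐ stab in
          ≐-trans (⊕-cong (coset-0# A-sub) f≐)
            (≐-trans (stabiliser-intro A-sub 0# (subgroup 𝒞B) ab B⊆A) (≐-sym (coset-0# A-sub))) }
      where
        A-sub : IsSubgroup A
        A-sub = subgroup 𝒞A

    -- ... and it is the only neutral element up to ≐: a neutral e = c + C must
    -- stabilise a + A (so C ⊆ A, c ∈ A) and be stabilised by A (so A ⊆ C).
    neutral-unique : ∀ {X a A e} → 𝒞 A → X ≐ coset a A → IsNeutralOf Coset𝒞 X e → e ≐ A
    neutral-unique {X} {A = A} 𝒞A X≐ ((c , C , 𝒞C , e≐) , X⊕e , minimal) =
      ≐-trans e≐ (≐-trans (coset-cong C≐A) (coset-of-member (subgroup 𝒞A) cA))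
      where
        A-neutral : IsNeutralOf Coset𝒞 X A
        A-neutral = subgroup-neutral 𝒞A X≐

        e-stabilises : A c × C ⊆ A
        e-stabilises = stabilises 𝒞A 𝒞C X≐ e≐ X⊕e

        cA : A c
        cA = proj₁ e-stabilises

        A⊆C : A ⊆ C
        A⊆C = proj₂ (stabilises 𝒞C 𝒞A e≐ (coset-0# (subgroup 𝒞A))
                       (minimal A (proj₁ A-neutral) (proj₁ (proj₂ A-neutral))))

        C≐A : C ≐ A
        C≐A z = mk⇔ (proj₂ e-stabilises) A⊆C

    neutral-transport : ∀ {X A e} → IsNeutralOf Coset𝒞 X A → Coset𝒞 e → e ≐ A →
                        IsNeutralOf Coset𝒞 X e
    neutral-transport (_ , X⊕A , minimal) e-coset e≐A =
      e-coset , ≐-trans (⊕-cong ≐-refl e≐A) X⊕A ,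
      λ f f-coset stab → ≐-trans (⊕-cong e≐A ≐-refl) (≐-trans (minimal f f-coset stab) (≐-sym e≐A))

    coset-inverse : ∀ a {A} → 𝒞 A → (coset a A ⊕ coset (- a) A) ≐ A
    coset-inverse a {A} 𝒞A =
      ≐-trans (coset-⊕ a A (- a) A)
        (≐-trans (coset-cong (⊕-absorb A-sub (IsSubgroup.has-0 A-sub) (λ x → x)))
          (coset-of-member A-sub (subst A (sym (-‿inverseʳ a)) (IsSubgroup.has-0 A-sub))))
      where
        A-sub : IsSubgroup A
        A-sub = subgroup 𝒞A

    assembly : IsAssembly Coset𝒞 _≐_ _⊕_
    assembly = record
      { closed = λ { X Y (_ , _ , 𝒞A , X≐) (_ , _ , 𝒞B , Y≐) →
          let (c , C , 𝒞C , X⊕Y≐ , _) = sum-of-cosets 𝒞A 𝒞B X≐ Y≐ in c , C , 𝒞C , X⊕Y≐ }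
      ; ∙-cong = λ _ _ _ _ → ⊕-cong
      ; assoc = λ S T U _ _ _ → ⊕-assoc S T U
      ; comm = λ S T _ _ → ⊕-comm S T
      ; neutral = λ { X (_ , A , 𝒞A , X≐) → A , subgroup-neutral 𝒞A X≐ }
      ; inverse = λ { X e (a , A , 𝒞A , X≐) e-neutral →
          let e≐A = neutral-unique 𝒞A X≐ e-neutral in
          coset (- a) A , (- a , A , 𝒞A , ≐-refl) ,
          ≐-trans (⊕-cong X≐ ≐-refl) (≐-trans (coset-inverse a 𝒞A) (≐-sym e≐A)) ,
          neutral-transport (subgroup-neutral 𝒞A ≐-refl) (proj₁ e-neutral) e≐A }
      ; neutral-sum = λ { X Y ex ey exy (_ , A , 𝒞A , X≐) (_ , B , 𝒞B , Y≐) ex-neutral ey-neutral exy-neutral →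
          let (_ , C , 𝒞C , X⊕Y≐ , C≡A⊎C≡B) = sum-of-cosets 𝒞A 𝒞B X≐ Y≐
              exy≐C = neutral-unique 𝒞C X⊕Y≐ exy-neutral in
          larger-is-neutral C≡A⊎C≡B exy≐C
            (neutral-unique 𝒞A X≐ ex-neutral) (neutral-unique 𝒞B Y≐ ey-neutral) }
      }
      where
        larger-is-neutral : ∀ {A B C ex ey exy} → C ≡ A ⊎ C ≡ B →
                            exy ≐ C → ex ≐ A → ey ≐ B → exy ≐ ex ⊎ exy ≐ ey
        larger-is-neutral (inj₁ refl) exy≐C ex≐A _ = inj₁ (≐-trans exy≐C (≐-sym ex≐A))
        larger-is-neutral (inj₂ refl) exy≐C _ ey≐B = inj₂ (≐-trans exy≐C (≐-sym ey≐B))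

  neg-antitone : ∀ {x y} → x ≤ y → - y ≤ - x
  neg-antitone {x} {y} x≤y = subst₂ _≤_ (\\-leftDividesˡ x (- y)) y-cancels (+-mono-≤ (- x + - y) x≤y)
    where
      y-cancels : y + (- x + - y) ≡ - x
      y-cancels = trans (cong (y +_) (+-comm (- x) (- y))) (\\-leftDividesˡ y (- x))

  module _ {A B : Subset} (A-cvx : IsConvexSubgroup A) (B-cvx : IsConvexSubgroup B) where
    module CA = IsConvexSubgroup A-cvx
    module CB = IsConvexSubgroup B-cvx

    nonneg-outsider : ∀ {x} → A x → ¬ B x → ∃ λ p → A p × ¬ B p × 0# ≤ p
    nonneg-outsider {x} ax x∉B with total x 0#
    ... | inj₂ 0≤x = x , ax , x∉B , 0≤x
    ... | inj₁ x≤0 = - x , CA.neg-closed ax ,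
            (λ b → x∉B (subst B (⁻¹-involutive x) (CB.neg-closed b))) ,
            subst (_≤ - x) ε⁻¹≈ε (neg-antitone x≤0)

    -- B is convex and contains 0, so it lies below any non-negative p ∉ B.
    below-outsider : ∀ {p y} → ¬ B p → 0# ≤ p → B y → y ≤ p
    below-outsider p∉B 0≤p by with total _ _
    ... | inj₁ p≤y = contradiction (CB.convex CB.has-0 by 0≤p p≤y) p∉B
    ... | inj₂ y≤p = y≤p

    -- Hence B ⊆ [-p, p] ⊆ A whenever some p ≥ 0 of A lies outside B.
    inside-outsider : ∀ {p} → A p → ¬ B p → 0# ≤ p → B ⊆ A
    inside-outsider {p} ap p∉B 0≤p {y} by = CA.convex (CA.neg-closed ap) ap -p≤y y≤p
      where
        y≤p : y ≤ p
        y≤p = below-outsider p∉B 0≤p by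

        -p≤y : - p ≤ y
        -p≤y = subst (- p ≤_) (⁻¹-involutive y) (neg-antitone (below-outsider p∉B 0≤p (CB.neg-closed by)))

  decide : ExcludedMiddle (suc zero) → (P : Set) → Dec P
  decide em P = map′ lower lift em

  convex-chain : ExcludedMiddle (suc zero) →
                 ∀ {A B} → IsConvexSubgroup A → IsConvexSubgroup B → B ⊆ A ⊎ A ⊆ B
  convex-chain em {A} {B} A-cvx B-cvx with decide em (∃ λ x → A x × ¬ B x)
  ... | yes (x , ax , x∉B) =
    let (p , ap , p∉B , 0≤p) = nonneg-outsider A-cvx B-cvx ax x∉B in
    inj₁ (inside-outsider A-cvx B-cvx ap p∉B 0≤p)
  ... | no A⊈B = inj₂ λ {x} ax → decidable-stable (decide em (B x)) (λ x∉B → A⊈B (x , ax , x∉B))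

  convex-subgroup : ∀ {A} → IsConvexSubgroup A → IsSubgroup A
  convex-subgroup A-cvx = record
    { has-0 = IsConvexSubgroup.has-0 A-cvx
    ; +-closed = IsConvexSubgroup.+-closed A-cvx
    ; neg-closed = IsConvexSubgroup.neg-closed A-cvx
    }

proposition3p4 : ExcludedMiddle (suc zero) → (F : OrderedField) → OrderedField.NonArchimedean F →
    IsAssembly (OrderedField.Q F) (OrderedField._≐_ F) (OrderedField._⊕_ F)
proposition3p4 em F _ =
  Cosets.Chain.assembly F (OrderedField.IsConvexSubgroup F)
    (Cosets.convex-subgroup F) (Cosets.convex-chain F em)
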